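{- Let $r,s$ be coprime positive integers. The generating function $\widetilde\delta^{r/s}(x)=\sum_{n\ge0}|\widetilde R_n^{r/s}|\,x^n$ is $$ \widetilde\delta^{r/s}(x)=\frac{1-\sum_{p=1}^{r} x^{p+\lceil ps/r\rceil}}{1-x-\sum_{p=1}^{r} x^{p+\lceil ps/r\rceil}}. $$
   Context: Let $\mathcal D$ be the set of Dyck paths of height at most $2$: words over $\{U,D\}$ ($U=(1,1)$, $D=(1,-1)$) from $(0,0)$ to $(2n,0)$ never going below the $x$-axis and whose $U$ steps reach ordinate at most $2$; $n$ is the semilength, and the empty path $\varepsilon$ has semilength $0$. Every nonempty $P\in\mathcal D$ has the form $UwD$ where $w$ is a word in the factors $UD$ and $DU$; grouping $w$ into maximal runs gives the factorization $P=U(UD)^{p_1}(DU)^{v_1}(UD)^{p_2}(DU)^{v_2}\cdots(UD)^{p_k}(DU)^{v_k}D$, where $p_1\ge0$ and $v_k\ge0$ may be zero and all other exponents are positive; for $P=UD$ one has $k=0$. For coprime positive integers $r,s$, $\widetilde R_n^{r/s}$ is the set of paths $P\in\mathcal D$ of semilength $n$ such that, for every $i=1,\dots,k$, $p_i\le r$ and $v_i\ge\lceil p_i s/r\rceil$ (so $\widetilde R_0^{r/s}=\{\varepsilon\}$). -}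

module Defs where

open import Data.Bool using (Bool; true; false; _∧_; if_then_else_)
open import Data.Nat as ℕ using (ℕ; zero; suc; _+_; _≤ᵇ_; _≡ᵇ_; _/_)
open import Data.Integer as ℤ using (ℤ; +_; _-_)
open import Data.List using (List; []; _∷_; _++_; length; filterᵇ; reverse; concatMap)
open import Data.Maybe using (Maybe; just; nothing)
open import Data.Product using (_×_; _,_)

data Step : Set where
  U D : Step

words : ℕ → List (List Step)
words zero    = [] ∷ []
words (suc m) = concatMap (λ w → (U ∷ w) ∷ (D ∷ w) ∷ []) (words m)

walkOK : ℕ → List Step → Bool
walkOK h []            = h ≡ᵇ 0
walkOK h (U ∷ w)       = (suc h ≤ᵇ 2) ∧ walkOK (suc h) w
walkOK zero (D ∷ w)    = false
walkOK (suc h) (D ∷ w) = walkOK h w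

isDyck2 : List Step → Bool
isDyck2 = walkOK 0

-- Factorization P = U w D, w a word in the factors UD (tokA) and DU (tokB)

data Tok : Set where
  tokA tokB : Tok

strip : List Step → Maybe (List Step)
strip (U ∷ rest) with reverse rest
... | D ∷ wr = just (reverse wr)
... | _      = nothing
strip _ = nothing

tokens : List Step → Maybe (List Tok)
tokens [] = just []
tokens (U ∷ D ∷ w) with tokens w
... | just ts = just (tokA ∷ ts)
... | nothing = nothing
tokens (D ∷ U ∷ w) with tokens w
... | just ts = just (tokB ∷ ts)
... | nothing = nothing
tokens _ = nothing

-- grouping into maximal runs: the list [(p₁,v₁),…,(p_k,v_k)] with
-- w = (UD)^{p₁}(DU)^{v₁}⋯(UD)^{p_k}(DU)^{v_k}, p₁ ≥ 0, v_k ≥ 0, others > 0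
blocksGo : List (ℕ × ℕ) → ℕ → ℕ → List Tok → List (ℕ × ℕ)
blocksGo acc p v []            = reverse ((p , v) ∷ acc)
blocksGo acc p zero (tokA ∷ ts)    = blocksGo acc (suc p) zero ts
blocksGo acc p (suc v) (tokA ∷ ts) = blocksGo ((p , suc v) ∷ acc) 1 0 ts
blocksGo acc p v (tokB ∷ ts)   = blocksGo acc p (suc v) ts

blocks : List Tok → List (ℕ × ℕ)
blocks [] = []
blocks ts@(_ ∷ _) = blocksGo [] 0 0 ts

-- ceiling division ⌈a / b⌉ (b > 0; value 0 for b = 0, never used)
ceilDiv : ℕ → ℕ → ℕ
ceilDiv a zero    = 0
ceilDiv a (suc b) = (a + b) / suc b

blockOK : ℕ → ℕ → ℕ × ℕ → Bool
blockOK r s (p , v) = (p ≤ᵇ r) ∧ (ceilDiv (p ℕ.* s) r ≤ᵇ v)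

allᵇ : {A : Set} → (A → Bool) → List A → Bool
allᵇ f [] = true
allᵇ f (x ∷ xs) = f x ∧ allᵇ f xs

inR : ℕ → ℕ → List Step → Bool
inR r s [] = true
inR r s P@(_ ∷ _) with isDyck2 P | strip P
... | true | just w with tokens w
...   | just ts = allᵇ (blockOK r s) (blocks ts)
...   | nothing = false
inR r s P@(_ ∷ _) | _ | _ = false

countR : ℕ → ℕ → ℕ → ℕ
countR r s n = length (filterᵇ (inR r s) (words (2 ℕ.* n)))

FPS : Set
FPS = ℕ → ℤ

sumTo : ℕ → (ℕ → ℤ) → ℤ
sumTo zero    f = f 0
sumTo (suc n) f = sumTo n f ℤ.+ f (suc n)

sum1 : ℕ → (ℕ → FPS) → FPS
sum1 zero    f n = + 0
sum1 (suc r) f n = sum1 r f n ℤ.+ f (suc r) n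

_*ₛ_ : FPS → FPS → FPS
(f *ₛ g) n = sumTo n (λ k → f k ℤ.* g (n ℕ.∸ k))

_-ₛ_ : FPS → FPS → FPS
(f -ₛ g) n = f n - g n

X^ : ℕ → FPS
X^ e n = if e ≡ᵇ n then + 1 else + 0

oneₛ : FPS
oneₛ = X^ 0

delta : ℕ → ℕ → FPS
delta r s n = + countR r s n

Ssum : ℕ → ℕ → FPS
Ssum r s = sum1 r (λ p → X^ (p + ceilDiv (p ℕ.* s) r))

-- For n ≥ 1 a path of R̃ₙ is U w D with w a word of length n - 1 in the tokens A = UD and B = DU,
-- and the block conditions can be checked while reading w from the left.  A leading B changes
-- nothing, a leading A^p with p > r is fatal, and a leading A^p with 1 ≤ p ≤ r forces the next
-- ⌈ps/r⌉ tokens to be B, after which the rest is again an arbitrary valid word.  So the number aₘ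
-- of valid token words of length m satisfies a = 1 + x a + Σₚ x^{p + ⌈ps/r⌉} a, and
-- δ̃ = 1 + x a then gives δ̃ (1 - x - Σₚ x^{p + ⌈ps/r⌉}) = 1 - Σₚ x^{p + ⌈ps/r⌉}.

module Submission where

open import Defs
open import Data.Bool using (Bool; true; false; _∧_)
open import Data.Bool.Properties using (∧-assoc; ∧-comm; ∧-identityʳ; ∧-zeroʳ)
open import Data.Nat as ℕ using (ℕ; zero; suc; pred; _+_; _*_; _∸_; _≤_; _<_; _≤ᵇ_; _≡ᵇ_; z≤n; s≤s)
open import Data.Nat.Coprimality using (Coprime)
open import Data.Nat.DivMod using (m<n⇒m/n≡0; m≥n⇒m/n>0)
open import Data.Nat.Properties as ℕ
  using (_≤?_; +-assoc; +-comm; +-suc; +-identityʳ; ≤-trans; ≤-reflexive; m≤m+n; m≤n+m; m≤n⇒m≤1+n;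
         m<m+n; m<n⇒m<1+n; n<1+n; <⇒≱; suc-pred)
open import Data.Nat.Tactic.RingSolver using (solve-∀)
open import Algebra.Properties.CommutativeSemigroup ℕ.+-commutativeSemigroup using ()
  renaming (interchange to +-interchange)
open import Data.Integer as ℤ using (ℤ)
import Data.Integer.Properties as ℤ
import Data.Integer.Tactic.RingSolver as ℤ-Solver
open import Data.List using (List; []; _∷_; _++_; length; filterᵇ; reverse; concatMap)
open import Data.List.Properties using (reverse-++; reverse-involutive; unfold-reverse)
open import Data.Maybe using (just; nothing; maybe′)
open import Data.Product using (_×_; _,_)
open import Function using (_∘_)
open import Relation.Nullary.Decidable using (dec-true; dec-false)
open import Relation.Binary.PropositionalEquality

toℕ : Bool → ℕ
toℕ true  = 1
toℕ false = 0

≤ᵇ-true : ∀ {m n} → m ≤ n → (m ≤ᵇ n) ≡ true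
≤ᵇ-true {m} {n} = dec-true (m ≤? n)

≤ᵇ-false : ∀ {m n} → n < m → (m ≤ᵇ n) ≡ false
≤ᵇ-false {m} {n} n<m = dec-false (m ≤? n) (<⇒≱ n<m)

ceilDiv-zero : ∀ b → ceilDiv 0 b ≡ 0
ceilDiv-zero zero    = refl
ceilDiv-zero (suc b) = m<n⇒m/n≡0 (n<1+n b)

ceilDiv-pos : ∀ {a b} → 0 < a → 0 < b → 0 < ceilDiv a b
ceilDiv-pos {suc a} {suc b} _ _ = m≥n⇒m/n>0 (s≤s (m≤n+m b a))

∑ : ℕ → (ℕ → ℕ) → ℕ
∑ zero    f = 0
∑ (suc n) f = ∑ n f + f (suc n)

∑-cong : ∀ n {f g} → (∀ j → 1 ≤ j → j ≤ n → f j ≡ g j) → ∑ n f ≡ ∑ n g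
∑-cong zero    f≡g = refl
∑-cong (suc n) f≡g =
  cong₂ _+_ (∑-cong n (λ j 1≤j j≤n → f≡g j 1≤j (m≤n⇒m≤1+n j≤n))) (f≡g (suc n) (s≤s z≤n) ℕ.≤-refl)

∑-zero : ∀ n {f} → (∀ j → 1 ≤ j → j ≤ n → f j ≡ 0) → ∑ n f ≡ 0
∑-zero zero    f≡0 = refl
∑-zero (suc n) f≡0 =
  cong₂ _+_ (∑-zero n (λ j 1≤j j≤n → f≡0 j 1≤j (m≤n⇒m≤1+n j≤n))) (f≡0 (suc n) (s≤s z≤n) ℕ.≤-refl)

∑-+ : ∀ n f g → ∑ n (λ j → f j + g j) ≡ ∑ n f + ∑ n g
∑-+ zero    f g = refl
∑-+ (suc n) f g =
  trans (cong (_+ (f (suc n) + g (suc n))) (∑-+ n f g)) (+-interchange (∑ n f) (∑ n g) (f (suc n)) (g (suc n)))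

shift : ℕ → (ℕ → ℕ) → ℕ → ℕ
shift zero    f n       = f n
shift (suc d) f zero    = 0
shift (suc d) f (suc n) = shift d f n

shift-cong : ∀ d {f g} → (∀ n → f n ≡ g n) → ∀ n → shift d f n ≡ shift d g n
shift-cong zero    f≡g n       = f≡g n
shift-cong (suc d) f≡g zero    = refl
shift-cong (suc d) f≡g (suc n) = shift-cong d f≡g n

shift-zero : ∀ d {f} → (∀ n → f n ≡ 0) → ∀ n → shift d f n ≡ 0
shift-zero zero    f≡0 n       = f≡0 n
shift-zero (suc d) f≡0 zero    = refl
shift-zero (suc d) f≡0 (suc n) = shift-zero d f≡0 n

shift-shift : ∀ d e f n → shift d (shift e f) n ≡ shift (d + e) f n
shift-shift zero    e f n       = refl
shift-shift (suc d) e f zero    = refl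
shift-shift (suc d) e f (suc n) = shift-shift d e f n

shift-pos-zero : ∀ {d} f → 0 < d → shift d f 0 ≡ 0
shift-pos-zero f (s≤s _) = refl

shift-step : ∀ {f g h} → f 0 ≡ 0 → (∀ n → f (suc n) ≡ g n + h n) →
             ∀ d n → shift d f n ≡ shift (suc d) g n + shift (suc d) h n
shift-step f0 fsuc zero    zero    = f0
shift-step f0 fsuc zero    (suc n) = fsuc n
shift-step f0 fsuc (suc d) zero    = refl
shift-step f0 fsuc (suc d) (suc n) = shift-step f0 fsuc d n

telescope : (F G : ℕ → ℕ → ℕ) → (∀ p → F (suc p) 0 ≡ 0) →
            (∀ p n → F p (suc n) ≡ F (suc p) n + G p n) →
            ∀ k n → F 1 n ≡ ∑ k (λ j → shift j (G j) n) + shift k (F (suc k)) n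
telescope F G F0 Fsuc zero    n = refl
telescope F G F0 Fsuc (suc k) n = begin
    F 1 n
  ≡⟨ telescope F G F0 Fsuc k n ⟩
    Gs + shift k (F (suc k)) n
  ≡⟨ cong (Gs +_) (shift-step (F0 k) (Fsuc (suc k)) k n) ⟩
    Gs + (shift (suc k) (F (suc (suc k))) n + shift (suc k) (G (suc k)) n)
  ≡⟨ cong (Gs +_) (+-comm (shift (suc k) (F (suc (suc k))) n) (shift (suc k) (G (suc k)) n)) ⟩
    Gs + (shift (suc k) (G (suc k)) n + shift (suc k) (F (suc (suc k))) n)
  ≡⟨ +-assoc Gs (shift (suc k) (G (suc k)) n) (shift (suc k) (F (suc (suc k))) n) ⟨
    Gs + shift (suc k) (G (suc k)) n + shift (suc k) (F (suc (suc k))) n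
  ∎
  where
  open ≡-Reasoning
  Gs = ∑ k (λ j → shift j (G j) n)

X^ℕ : ℕ → ℕ → ℕ
X^ℕ e n = toℕ (e ≡ᵇ n)

X^ℕ-pos-zero : ∀ {e} → 0 < e → X^ℕ e 0 ≡ 0
X^ℕ-pos-zero (s≤s _) = refl

module _ (R : ℕ) (E : ℕ → ℕ) (0<E : ∀ j → 1 ≤ j → j ≤ R → 0 < E j) (a c : ℕ → ℕ)
         (a-zero : a 0 ≡ 1) (a-suc : ∀ m → a (suc m) ≡ a m + ∑ R (λ j → shift (E j) a (suc m)))
         (c-zero : c 0 ≡ 1) (c-suc : ∀ m → c (suc m) ≡ a m) where

  private
    a-equation : ∀ m → a m ≡ c m + ∑ R (λ j → shift (E j) a m)
    a-equation zero    =
      trans a-zero (sym (cong₂ _+_ c-zero (∑-zero R (λ j 1≤j j≤R → shift-pos-zero a (0<E j 1≤j j≤R)))))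
    a-equation (suc m) = trans (a-suc m) (cong (_+ _) (sym (c-suc m)))

    shift-c : ∀ d n → shift d c n ≡ X^ℕ d n + shift (suc d) a n
    shift-c zero    zero    = c-zero
    shift-c zero    (suc n) = c-suc n
    shift-c (suc d) zero    = refl
    shift-c (suc d) (suc n) = shift-c d n

  coefficient-identity : ∀ n → c n + ∑ R (λ j → X^ℕ (E j) n)
                                ≡ X^ℕ 0 n + shift 1 c n + ∑ R (λ j → shift (E j) c n)
  coefficient-identity zero    =
    trans (cong₂ _+_ c-zero (∑-zero R (λ j 1≤j j≤R → X^ℕ-pos-zero (0<E j 1≤j j≤R))))
          (sym (cong (1 +_) (∑-zero R (λ j 1≤j j≤R → shift-pos-zero c (0<E j 1≤j j≤R)))))
  coefficient-identity (suc m) = begin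
      c (suc m) + Xs
    ≡⟨ cong (_+ Xs) (trans (c-suc m) (a-equation m)) ⟩
      c m + Sa + Xs
    ≡⟨ +-assoc (c m) Sa Xs ⟩
      c m + (Sa + Xs)
    ≡⟨ cong (c m +_) (+-comm Sa Xs) ⟩
      c m + (Xs + Sa)
    ≡⟨ cong (c m +_) (∑-+ R _ _) ⟨
      c m + ∑ R (λ j → X^ℕ (E j) (suc m) + shift (E j) a m)
    ≡⟨ cong (c m +_) (∑-cong R (λ j _ _ → shift-c (E j) (suc m))) ⟨
      c m + ∑ R (λ j → shift (E j) c (suc m))
    ∎
    where
    open ≡-Reasoning
    Xs = ∑ R (λ j → X^ℕ (E j) (suc m))
    Sa = ∑ R (λ j → shift (E j) a m)

module Count {X : Set} (x y : X) where

  count : ℕ → (List X → Bool) → ℕ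
  count zero    P = toℕ (P [])
  count (suc m) P = count m (P ∘ (x ∷_)) + count m (P ∘ (y ∷_))

  count-cong : ∀ m {P Q} → (∀ w → P w ≡ Q w) → count m P ≡ count m Q
  count-cong zero    P≡Q = cong toℕ (P≡Q [])
  count-cong (suc m) P≡Q = cong₂ _+_ (count-cong m (P≡Q ∘ (x ∷_))) (count-cong m (P≡Q ∘ (y ∷_)))

  count-false : ∀ m {P} → (∀ w → P w ≡ false) → count m P ≡ 0
  count-false zero    P≡false = cong toℕ (P≡false [])
  count-false (suc m) P≡false = cong₂ _+_ (count-false m (P≡false ∘ (x ∷_))) (count-false m (P≡false ∘ (y ∷_)))

  count-∷ʳ : ∀ m P → count (suc m) P ≡ count m (λ w → P (w ++ x ∷ [])) + count m (λ w → P (w ++ y ∷ []))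
  count-∷ʳ zero    P = refl
  count-∷ʳ (suc m) P =
    trans (cong₂ _+_ (count-∷ʳ m (P ∘ (x ∷_))) (count-∷ʳ m (P ∘ (y ∷_))))
          (+-interchange (ending x x) (ending x y) (ending y x) (ending y y))
    where
    ending : X → X → ℕ
    ending first last = count m (λ w → P (first ∷ w ++ last ∷ []))

module Steps = Count U D
module Toks  = Count tokA tokB

length-filter-∷ : ∀ {A : Set} (P : A → Bool) z zs →
                  length (filterᵇ P (z ∷ zs)) ≡ toℕ (P z) + length (filterᵇ P zs)
length-filter-∷ P z zs with P z
... | true  = refl
... | false = refl

length-filter-branch : ∀ P ws →
  length (filterᵇ P (concatMap (λ w → (U ∷ w) ∷ (D ∷ w) ∷ []) ws))
    ≡ length (filterᵇ (P ∘ (U ∷_)) ws) + length (filterᵇ (P ∘ (D ∷_)) ws)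
length-filter-branch P []       = refl
length-filter-branch P (w ∷ ws) = begin
    length (filterᵇ P ((U ∷ w) ∷ (D ∷ w) ∷ concatMap _ ws))
  ≡⟨ trans (length-filter-∷ P _ _) (cong (toℕ (P (U ∷ w)) +_) (length-filter-∷ P _ _)) ⟩
    toℕ (P (U ∷ w)) + (toℕ (P (D ∷ w)) + length (filterᵇ P (concatMap _ ws)))
  ≡⟨ cong (λ z → toℕ (P (U ∷ w)) + (toℕ (P (D ∷ w)) + z)) (length-filter-branch P ws) ⟩
    headU + (headD + (tailU + tailD))
  ≡⟨ trans (sym (+-assoc headU headD (tailU + tailD))) (+-interchange headU headD tailU tailD) ⟩
    (headU + tailU) + (headD + tailD)
  ≡⟨ cong₂ _+_ (length-filter-∷ (P ∘ (U ∷_)) w ws) (length-filter-∷ (P ∘ (D ∷_)) w ws) ⟨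
    length (filterᵇ (P ∘ (U ∷_)) (w ∷ ws)) + length (filterᵇ (P ∘ (D ∷_)) (w ∷ ws))
  ∎
  where
  open ≡-Reasoning
  headU = toℕ (P (U ∷ w))
  headD = toℕ (P (D ∷ w))
  tailU = length (filterᵇ (P ∘ (U ∷_)) ws)
  tailD = length (filterᵇ (P ∘ (D ∷_)) ws)

length-filter-words : ∀ m P → length (filterᵇ P (words m)) ≡ Steps.count m P
length-filter-words zero    P = trans (length-filter-∷ P [] []) (+-identityʳ _)
length-filter-words (suc m) P =
  trans (length-filter-branch P (words m)) (cong₂ _+_ (length-filter-words m _) (length-filter-words m _))

tokens-UD : ∀ (T : List Tok → Bool) w →
            maybe′ T false (tokens (U ∷ D ∷ w)) ≡ maybe′ (T ∘ (tokA ∷_)) false (tokens w)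
tokens-UD T w with tokens w
... | just _  = refl
... | nothing = refl

tokens-DU : ∀ (T : List Tok → Bool) w →
            maybe′ T false (tokens (D ∷ U ∷ w)) ≡ maybe′ (T ∘ (tokB ∷_)) false (tokens w)
tokens-DU T w with tokens w
... | just _  = refl
... | nothing = refl

count-tokens : ∀ m T → Steps.count (m + m) (maybe′ T false ∘ tokens) ≡ Toks.count m T
count-tokens zero    T = refl
count-tokens (suc m) T rewrite +-suc m m =
  cong₂ _+_
    (cong₂ _+_ (Steps.count-false (m + m) (λ _ → refl))
               (trans (Steps.count-cong (m + m) (tokens-UD T)) (count-tokens m _)))
    (trans (cong₂ _+_ (trans (Steps.count-cong (m + m) (tokens-DU T)) (count-tokens m _))
                      (Steps.count-false (m + m) (λ _ → refl)))
           (+-identityʳ _))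

strip-ending-D : ∀ w → strip (U ∷ w ++ D ∷ []) ≡ just w
strip-ending-D w rewrite reverse-++ w (D ∷ []) = cong just (reverse-involutive w)

strip-ending-U : ∀ w → strip (U ∷ w ++ U ∷ []) ≡ nothing
strip-ending-U w rewrite reverse-++ w (U ∷ []) = refl

walkOK-tokens : ∀ w ts → tokens w ≡ just ts → walkOK 1 (w ++ D ∷ []) ≡ true
walkOK-tokens []          ts eq = refl
walkOK-tokens (U ∷ D ∷ w) ts eq with tokens w in eq′
... | just ts′ = walkOK-tokens w ts′ eq′
walkOK-tokens (D ∷ U ∷ w) ts eq with tokens w in eq′
... | just ts′ = walkOK-tokens w ts′ eq′

valid : ℕ → ℕ → List Tok → Bool
valid r s ts = allᵇ (blockOK r s) (blocks ts)

module _ (r s : ℕ) where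

  inR-ending-U : ∀ w → inR r s (U ∷ w ++ U ∷ []) ≡ false
  inR-ending-U w rewrite strip-ending-U w with walkOK 1 (w ++ U ∷ [])
  ... | true  = refl
  ... | false = refl

  inR-ending-D : ∀ w → inR r s (U ∷ w ++ D ∷ []) ≡ maybe′ (valid r s) false (tokens w)
  inR-ending-D w with tokens w in eq
  ... | just ts rewrite walkOK-tokens w ts eq | strip-ending-D w | eq = refl
  ... | nothing rewrite strip-ending-D w with walkOK 1 (w ++ D ∷ [])
  ...   | true rewrite eq = refl
  ...   | false           = refl

  countR-suc : ∀ n → countR r s (suc n) ≡ Toks.count n (valid r s)
  countR-suc n = begin
      length (filterᵇ (inR r s) (words (2 * suc n)))
    ≡⟨ length-filter-words (2 * suc n) (inR r s) ⟩
      Steps.count (2 * suc n) (inR r s)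
    ≡⟨ cong (λ m → Steps.count m (inR r s)) (double-suc n) ⟩
      Steps.count (suc (n + n)) (inR r s ∘ (U ∷_)) + Steps.count (suc (n + n)) (inR r s ∘ (D ∷_))
    ≡⟨ cong₂ _+_ (Steps.count-∷ʳ (n + n) (inR r s ∘ (U ∷_))) (Steps.count-false (suc (n + n)) (λ _ → refl)) ⟩
      endingU + endingD + 0
    ≡⟨ +-identityʳ (endingU + endingD) ⟩
      endingU + endingD
    ≡⟨ cong₂ _+_ (Steps.count-false (n + n) inR-ending-U) (Steps.count-cong (n + n) inR-ending-D) ⟩
      Steps.count (n + n) (maybe′ (valid r s) false ∘ tokens)
    ≡⟨ count-tokens n (valid r s) ⟩
      Toks.count n (valid r s)
    ∎
    where
    open ≡-Reasoning
    double-suc : ∀ n → 2 * suc n ≡ suc (suc (n + n))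
    double-suc = solve-∀
    endingU endingD : ℕ
    endingU = Steps.count (n + n) (λ w → inR r s (U ∷ w ++ U ∷ []))
    endingD = Steps.count (n + n) (λ w → inR r s (U ∷ w ++ D ∷ []))

allᵇ-++ : ∀ {A : Set} (f : A → Bool) xs ys → allᵇ f (xs ++ ys) ≡ allᵇ f xs ∧ allᵇ f ys
allᵇ-++ f []       ys = refl
allᵇ-++ f (z ∷ xs) ys = trans (cong (f z ∧_) (allᵇ-++ f xs ys)) (sym (∧-assoc (f z) _ _))

allᵇ-reverse : ∀ {A : Set} (f : A → Bool) xs → allᵇ f (reverse xs) ≡ allᵇ f xs
allᵇ-reverse f []       = refl
allᵇ-reverse f (z ∷ xs) = begin
    allᵇ f (reverse (z ∷ xs))          ≡⟨ cong (allᵇ f) (unfold-reverse z xs) ⟩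
    allᵇ f (reverse xs ++ z ∷ [])      ≡⟨ allᵇ-++ f (reverse xs) (z ∷ []) ⟩
    allᵇ f (reverse xs) ∧ (f z ∧ true) ≡⟨ cong₂ _∧_ (allᵇ-reverse f xs) (∧-identityʳ (f z)) ⟩
    allᵇ f xs ∧ f z                    ≡⟨ ∧-comm (allᵇ f xs) (f z) ⟩
    f z ∧ allᵇ f xs                    ∎
  where open ≡-Reasoning

module Blocks (r s : ℕ) where

  q : ℕ → ℕ
  q p = ceilDiv (p * s) r

  exponent : ℕ → ℕ
  exponent p = p + q p

  ok : ℕ × ℕ → Bool
  ok = blockOK r s

  -- validAfter p v ts is the validity of A^p B^v ts, whose first block A^p B^v may still grow.
  validAfter : ℕ → ℕ → List Tok → Bool
  validAfter p v       []          = ok (p , v)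
  validAfter p v       (tokB ∷ ts) = validAfter p (suc v) ts
  validAfter p zero    (tokA ∷ ts) = validAfter (suc p) zero ts
  validAfter p (suc v) (tokA ∷ ts) = ok (p , suc v) ∧ validAfter 1 0 ts

  allᵇ-blocksGo : ∀ acc p v ts → allᵇ ok (blocksGo acc p v ts) ≡ allᵇ ok acc ∧ validAfter p v ts
  allᵇ-blocksGo acc p v       []          = trans (allᵇ-reverse ok ((p , v) ∷ acc)) (∧-comm (ok (p , v)) _)
  allᵇ-blocksGo acc p zero    (tokA ∷ ts) = allᵇ-blocksGo acc (suc p) zero ts
  allᵇ-blocksGo acc p (suc v) (tokA ∷ ts) =
    trans (allᵇ-blocksGo ((p , suc v) ∷ acc) 1 0 ts)
          (trans (cong (_∧ validAfter 1 0 ts) (∧-comm (ok (p , suc v)) (allᵇ ok acc)))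
                 (∧-assoc (allᵇ ok acc) (ok (p , suc v)) (validAfter 1 0 ts)))
  allᵇ-blocksGo acc p zero    (tokB ∷ ts) = allᵇ-blocksGo acc p 1 ts
  allᵇ-blocksGo acc p (suc v) (tokB ∷ ts) = allᵇ-blocksGo acc p (suc (suc v)) ts

  q-zero : q 0 ≡ 0
  q-zero = ceilDiv-zero r

  q-zero-≤ : ∀ v → q 0 ≤ v
  q-zero-≤ v = subst (_≤ v) (sym q-zero) z≤n

  ok-accept : ∀ {p v} → p ≤ r → q p ≤ v → ok (p , v) ≡ true
  ok-accept p≤r q≤v = cong₂ _∧_ (≤ᵇ-true p≤r) (≤ᵇ-true q≤v)

  ok-long : ∀ {p v} → r < p → ok (p , v) ≡ false
  ok-long {p} {v} r<p = cong (_∧ (q p ≤ᵇ v)) (≤ᵇ-false r<p)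

  ok-short : ∀ p {v} → v < q p → ok (p , v) ≡ false
  ok-short p v<q = trans (cong ((p ≤ᵇ r) ∧_) (≤ᵇ-false v<q)) (∧-zeroʳ (p ≤ᵇ r))

  valid≡validAfter : ∀ ts → valid r s ts ≡ validAfter 0 0 ts
  valid≡validAfter []      = sym (ok-accept z≤n (q-zero-≤ 0))
  valid≡validAfter (t ∷ ts) = allᵇ-blocksGo [] 0 0 (t ∷ ts)

  validAfter-long : ∀ {p v} ts → r < p → validAfter p v ts ≡ false
  validAfter-long         []          r<p = ok-long r<p
  validAfter-long         (tokB ∷ ts) r<p = validAfter-long ts r<p
  validAfter-long {v = zero}  (tokA ∷ ts) r<p = validAfter-long ts (m<n⇒m<1+n r<p)
  validAfter-long {v = suc v} (tokA ∷ ts) r<p = cong (_∧ validAfter 1 0 ts) (ok-long r<p)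

  validAfter-closed : ∀ {p v} → p ≤ r → q p ≤ suc v → ∀ ts → validAfter p (suc v) ts ≡ validAfter 0 0 ts
  validAfter-closed p≤r q≤v []          = trans (ok-accept p≤r q≤v) (sym (ok-accept z≤n (q-zero-≤ 0)))
  validAfter-closed p≤r q≤v (tokA ∷ ts) = cong (_∧ validAfter 1 0 ts) (ok-accept p≤r q≤v)
  validAfter-closed p≤r q≤v (tokB ∷ ts) =
    trans (validAfter-closed p≤r (m≤n⇒m≤1+n q≤v) ts) (sym (validAfter-closed z≤n (q-zero-≤ 1) ts))

module Recurrence (r s : ℕ) (0<r : 0 < r) (0<s : 0 < s) where
  open Blocks r s

  0<q : ∀ {p} → 0 < p → 0 < q p
  0<q {suc p} _ = ceilDiv-pos (≤-trans 0<s (m≤m+n s (p * s))) 0<r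

  0<exponent : ∀ j → 1 ≤ j → j ≤ r → 0 < exponent j
  0<exponent j 1≤j _ = ≤-trans 1≤j (m≤m+n j (q j))

  completions : ℕ → ℕ → ℕ → ℕ
  completions p v m = Toks.count m (validAfter p v)

  completions-open-zero : ∀ p → completions (suc p) 0 0 ≡ 0
  completions-open-zero p = cong toℕ (ok-short (suc p) (0<q {suc p} (s≤s z≤n)))

  completions-long : ∀ {p} v m → r < p → completions p v m ≡ 0
  completions-long v m r<p = Toks.count-false m (λ ts → validAfter-long ts r<p)

  -- after A^p B^(1+v), exactly d more B's are forced before the block closes
  completions-closing : ∀ {p} → p ≤ r → ∀ d v m → suc v + d ≡ q p →
                        completions p (suc v) m ≡ shift d (completions 0 0) m
  completions-closing p≤r zero    v m       eq =
    Toks.count-cong m (validAfter-closed p≤r (≤-reflexive (trans (sym eq) (+-identityʳ _))))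
  completions-closing {p} p≤r (suc d) v m eq = unfinished m
    where
    ok≡false : ok (p , suc v) ≡ false
    ok≡false = ok-short p (subst (suc v <_) eq (m<m+n (suc v) (s≤s z≤n)))
    unfinished : ∀ m → completions p (suc v) m ≡ shift (suc d) (completions 0 0) m
    unfinished zero    = cong toℕ ok≡false
    unfinished (suc m) =
      cong₂ _+_ (Toks.count-false m (λ ts → cong (_∧ validAfter 1 0 ts) ok≡false))
                (completions-closing p≤r d (suc v) m (trans (sym (+-suc (suc v) d)) eq))

  completions-AB : ∀ {p} → 0 < p → p ≤ r → ∀ m → completions p 1 m ≡ shift (pred (q p)) (completions 0 0) m
  completions-AB {p} 0<p p≤r m =
    completions-closing p≤r (pred (q p)) 0 m (suc-pred (q p) {{ℕ.>-nonZero (0<q 0<p)}})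

  -- A leading A^p needs 1 ≤ p ≤ r and is followed by ⌈ps/r⌉ forced B's (completions-AB).
  completions-A : ∀ m → completions 1 0 m ≡ ∑ r (λ j → shift (exponent j) (completions 0 0) (suc m))
  completions-A m = begin
      completions 1 0 m
    ≡⟨ telescope (λ p → completions p 0) (λ p → completions p 1) completions-open-zero (λ _ _ → refl) r m ⟩
      Gs + shift r (completions (suc r) 0) m
    ≡⟨ cong (Gs +_) (shift-zero r (λ m → completions-long 0 m ℕ.≤-refl) m) ⟩
      Gs + 0
    ≡⟨ +-identityʳ Gs ⟩
      Gs
    ≡⟨ ∑-cong r term ⟩
      ∑ r (λ j → shift (exponent j) (completions 0 0) (suc m))
    ∎
    where
    open ≡-Reasoning
    Gs = ∑ r (λ j → shift j (completions j 1) m)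
    term : ∀ j → 1 ≤ j → j ≤ r → shift j (completions j 1) m ≡ shift (exponent j) (completions 0 0) (suc m)
    term j 1≤j j≤r = begin
        shift j (completions j 1) m
      ≡⟨ shift-cong j (completions-AB 1≤j j≤r) m ⟩
        shift j (shift (pred (q j)) (completions 0 0)) m
      ≡⟨ shift-shift j (pred (q j)) (completions 0 0) m ⟩
        shift (suc (j + pred (q j))) (completions 0 0) (suc m)
      ≡⟨ cong (λ e → shift e (completions 0 0) (suc m))
              (trans (sym (+-suc j _)) (cong (j +_) (suc-pred (q j) {{ℕ.>-nonZero (0<q 1≤j)}}))) ⟩
        shift (exponent j) (completions 0 0) (suc m)
      ∎

  completions-suc : ∀ m → completions 0 0 (suc m)
                          ≡ completions 0 0 m + ∑ r (λ j → shift (exponent j) (completions 0 0) (suc m))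
  completions-suc m = begin
      completions 1 0 m + completions 0 1 m
    ≡⟨ cong (completions 1 0 m +_) (Toks.count-cong m (validAfter-closed z≤n (q-zero-≤ 1))) ⟩
      completions 1 0 m + completions 0 0 m
    ≡⟨ +-comm (completions 1 0 m) (completions 0 0 m) ⟩
      completions 0 0 m + completions 1 0 m
    ≡⟨ cong (completions 0 0 m +_) (completions-A m) ⟩
      completions 0 0 m + ∑ r (λ j → shift (exponent j) (completions 0 0) (suc m))
    ∎
    where open ≡-Reasoning

  countR-identity : ∀ n → countR r s n + ∑ r (λ j → X^ℕ (exponent j) n)
                          ≡ X^ℕ 0 n + shift 1 (countR r s) n + ∑ r (λ j → shift (exponent j) (countR r s) n)
  countR-identity =
    coefficient-identity r exponent 0<exponent (completions 0 0) (countR r s)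
      (cong toℕ (ok-accept z≤n (q-zero-≤ 0))) completions-suc
      refl (λ m → trans (countR-suc r s m) (Toks.count-cong m valid≡validAfter))

open import Data.Integer using (+_; _-_)

sumTo-cong : ∀ n {f g : ℕ → ℤ} → (∀ k → k ≤ n → f k ≡ g k) → sumTo n f ≡ sumTo n g
sumTo-cong zero    f≡g = f≡g 0 z≤n
sumTo-cong (suc n) f≡g = cong₂ ℤ._+_ (sumTo-cong n (λ k k≤n → f≡g k (m≤n⇒m≤1+n k≤n))) (f≡g (suc n) ℕ.≤-refl)

sumTo-zero : ∀ n → sumTo n (λ _ → + 0) ≡ + 0
sumTo-zero zero    = refl
sumTo-zero (suc n) = cong (ℤ._+ + 0) (sumTo-zero n)

sumTo-+ : ∀ n (f g : ℕ → ℤ) → sumTo n (λ k → f k ℤ.+ g k) ≡ sumTo n f ℤ.+ sumTo n g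
sumTo-+ zero    f g = refl
sumTo-+ (suc n) f g =
  trans (cong (ℤ._+ (f (suc n) ℤ.+ g (suc n))) (sumTo-+ n f g)) (interchange (sumTo n f) (sumTo n g) (f (suc n)) (g (suc n)))
  where
  interchange : ∀ a b c d → (a ℤ.+ b) ℤ.+ (c ℤ.+ d) ≡ (a ℤ.+ c) ℤ.+ (b ℤ.+ d)
  interchange = ℤ-Solver.solve-∀

sumTo-- : ∀ n (f g : ℕ → ℤ) → sumTo n (λ k → f k - g k) ≡ sumTo n f - sumTo n g
sumTo-- zero    f g = refl
sumTo-- (suc n) f g =
  trans (cong (ℤ._+ (f (suc n) - g (suc n))) (sumTo-- n f g)) (interchange (sumTo n f) (sumTo n g) (f (suc n)) (g (suc n)))
  where
  interchange : ∀ a b c d → (a - b) ℤ.+ (c - d) ≡ (a ℤ.+ c) - (b ℤ.+ d)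
  interchange = ℤ-Solver.solve-∀

*ₛ-distribˡ--ₛ : ∀ (f g h : FPS) n → (f *ₛ (g -ₛ h)) n ≡ (f *ₛ g) n - (f *ₛ h) n
*ₛ-distribˡ--ₛ f g h n = trans (sumTo-cong n (λ k _ → distrib (f k) (g (n ∸ k)) (h (n ∸ k)))) (sumTo-- n _ _)
  where
  distrib : ∀ a b c → a ℤ.* (b - c) ≡ a ℤ.* b - a ℤ.* c
  distrib = ℤ-Solver.solve-∀

*ₛ-distribˡ-sum1 : ∀ (f : FPS) R (F : ℕ → FPS) n → (f *ₛ sum1 R F) n ≡ sum1 R (λ p → f *ₛ F p) n
*ₛ-distribˡ-sum1 f zero    F n = trans (sumTo-cong n (λ k _ → ℤ.*-zeroʳ (f k))) (sumTo-zero n)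
*ₛ-distribˡ-sum1 f (suc R) F n =
  trans (sumTo-cong n (λ k _ → ℤ.*-distribˡ-+ (f k) (sum1 R F (n ∸ k)) (F (suc R) (n ∸ k))))
        (trans (sumTo-+ n _ _) (cong (ℤ._+ (f *ₛ F (suc R)) n) (*ₛ-distribˡ-sum1 f R F n)))

*ₛ-suc : ∀ (f g : FPS) n → (f *ₛ g) (suc n) ≡ (f *ₛ (g ∘ suc)) n ℤ.+ f (suc n) ℤ.* g 0
*ₛ-suc f g n = cong₂ ℤ._+_ (sumTo-cong n (λ k k≤n → cong (λ m → f k ℤ.* g m) (ℕ.+-∸-assoc 1 k≤n)))
                           (cong (λ m → f (suc n) ℤ.* g m) (ℕ.n∸n≡0 n))

*ₛ-zeroʳ : ∀ (f : FPS) n → (f *ₛ (λ _ → + 0)) n ≡ + 0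
*ₛ-zeroʳ f n = trans (sumTo-cong n (λ k _ → ℤ.*-zeroʳ (f k))) (sumTo-zero n)

*ₛ-X^ : ∀ (g : ℕ → ℕ) e n → ((λ k → + g k) *ₛ X^ e) n ≡ + shift e g n
*ₛ-X^ g zero    zero    = ℤ.*-identityʳ (+ g 0)
*ₛ-X^ g zero    (suc n) =
  trans (*ₛ-suc (λ k → + g k) (X^ 0) n) (cong₂ ℤ._+_ (*ₛ-zeroʳ (λ k → + g k) n) (ℤ.*-identityʳ (+ g (suc n))))
*ₛ-X^ g (suc e) zero    = ℤ.*-zeroʳ (+ g 0)
*ₛ-X^ g (suc e) (suc n) =
  trans (*ₛ-suc (λ k → + g k) (X^ (suc e)) n)
        (trans (cong₂ ℤ._+_ (*ₛ-X^ g e n) (ℤ.*-zeroʳ (+ g (suc n)))) (ℤ.+-identityʳ _))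

X^-toℕ : ∀ e n → X^ e n ≡ + X^ℕ e n
X^-toℕ e n with e ≡ᵇ n
... | true  = refl
... | false = refl

sum1-toℕ : ∀ R (g : ℕ → ℕ → ℕ) {F : ℕ → FPS} n →
           (∀ p → F p n ≡ + g p n) → sum1 R F n ≡ + ∑ R (λ p → g p n)
sum1-toℕ zero    g n F≡g = refl
sum1-toℕ (suc R) g n F≡g =
  trans (cong₂ ℤ._+_ (sum1-toℕ R g n F≡g) (F≡g (suc R))) (sym (ℤ.pos-+ (∑ R (λ p → g p n)) (g (suc R) n)))

pos-sub-sub : ∀ a b c d e → a + e ≡ d + b + c → (+ a - + b) - + c ≡ + d - + e
pos-sub-sub a b c d e eq = begin
    (+ a - + b) - + c
  ≡⟨ add-sub (+ a) (+ b) (+ c) (+ e) ⟩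
    (+ a ℤ.+ + e) - + b - + c - + e
  ≡⟨ cong (λ z → z - + b - + c - + e) eqℤ ⟩
    (+ d ℤ.+ + b ℤ.+ + c) - + b - + c - + e
  ≡⟨ cancel (+ d) (+ b) (+ c) (+ e) ⟩
    + d - + e
  ∎
  where
  open ≡-Reasoning
  eqℤ : + a ℤ.+ + e ≡ + d ℤ.+ + b ℤ.+ + c
  eqℤ = trans (sym (ℤ.pos-+ a e)) (trans (cong +_ eq) (trans (ℤ.pos-+ (d + b) c) (cong (ℤ._+ + c) (ℤ.pos-+ d b))))
  add-sub : ∀ x y z w → (x - y) - z ≡ (x ℤ.+ w) - y - z - w
  add-sub = ℤ-Solver.solve-∀
  cancel : ∀ x y z w → (x ℤ.+ y ℤ.+ z) - y - z - w ≡ x - w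
  cancel = ℤ-Solver.solve-∀

mainTheorem3 : (r s : ℕ) → 0 < r → 0 < s → Coprime r s →
    ∀ n → (delta r s *ₛ ((oneₛ -ₛ X^ 1) -ₛ Ssum r s)) n ≡ (oneₛ -ₛ Ssum r s) n
mainTheorem3 r s 0<r 0<s _ n = begin
    (δ *ₛ ((oneₛ -ₛ X^ 1) -ₛ Ssum r s)) n
  ≡⟨ *ₛ-distribˡ--ₛ δ (oneₛ -ₛ X^ 1) (Ssum r s) n ⟩
    (δ *ₛ (oneₛ -ₛ X^ 1)) n - (δ *ₛ Ssum r s) n
  ≡⟨ cong₂ _-_ (trans (*ₛ-distribˡ--ₛ δ oneₛ (X^ 1) n) (cong₂ _-_ (*ₛ-X^ c 0 n) (*ₛ-X^ c 1 n))) δ*Ssum ⟩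
    (+ c n - + shift 1 c n) - + Sc
  ≡⟨ pos-sub-sub (c n) (shift 1 c n) Sc (X^ℕ 0 n) SX (countR-identity n) ⟩
    + X^ℕ 0 n - + SX
  ≡⟨ cong₂ _-_ (X^-toℕ 0 n) (sum1-toℕ r (λ p → X^ℕ (exponent p)) n (λ p → X^-toℕ (exponent p) n)) ⟨
    (oneₛ -ₛ Ssum r s) n
  ∎
  where
  open ≡-Reasoning
  open Blocks r s using (exponent)
  open Recurrence r s 0<r 0<s using (countR-identity)
  δ : FPS
  δ = delta r s
  c : ℕ → ℕ
  c = countR r s
  Sc SX : ℕ
  Sc = ∑ r (λ p → shift (exponent p) c n)
  SX = ∑ r (λ p → X^ℕ (exponent p) n)
  δ*Ssum : (δ *ₛ Ssum r s) n ≡ + Sc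
  δ*Ssum = trans (*ₛ-distribˡ-sum1 δ r (λ p → X^ (exponent p)) n)
                 (sum1-toℕ r (λ p → shift (exponent p) c) n (λ p → *ₛ-X^ c (exponent p) n))
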